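{- Let $\alpha,\alpha',\beta,\beta'\in\mathcal{NCP}(n)$ with $\alpha\mid\alpha'$ and $\beta\mid\beta'$, and suppose that the pairs $(\alpha,\beta)$, $(\alpha',\beta)$, $(\alpha,\beta')$ are admissible. Then $\alpha\circ\beta\mid\alpha'\circ\beta$ and $\alpha\circ\beta\mid\alpha\circ\beta'$. Moreover, $\alpha\circ\beta\neq\alpha'\circ\beta$ if $\alpha\neq\alpha'$, and $\alpha\circ\beta\neq\alpha\circ\beta'$ if $\beta\neq\beta'$.
   Context: A partition of $[m]=\{1,\dots,m\}$ is noncrossing if there are no two distinct blocks $B,C$ and $a<b<c<d$ with $a,c\in B$, $b,d\in C$. $\mathcal{NCP}(m)$ is the lattice of noncrossing partitions of $[m]$ under refinement ($\pi\mid\mu$ iff each block of $\pi$ lies in a block of $\mu$), with join $\vee$. For $\alpha,\beta\in\mathcal{NCP}(n)$, $\alpha\ast_n\beta$ is the partition of $[2n]$ with blocks $\{2x-1:x\in B\}$ ($B$ a block of $\alpha$) and $\{2x:x\in C\}$ ($C$ a block of $\beta$); $(\alpha,\beta)$ is admissible if this is noncrossing, and then $\alpha\circ\beta:=\sqrt{(\alpha\ast_n\beta)\vee\{\{1,2\},\dots,\{2n-1,2n\}\}}$ (join in $\mathcal{NCP}(2n)$), where for $\gamma\in\mathcal{NCP}(2n)$ with $2i-1,2i$ always in the same block, $\sqrt\gamma\in\mathcal{NCP}(n)$ has blocks $\{i:2i\in D\}$, $D$ a block of $\gamma$. -}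

module Defs where

open import Data.Nat using (ℕ; _*_)
open import Data.Fin using (Fin; zero; suc; _<_; remQuot; combine)
open import Data.Bool using (Bool; true; false; T)
open import Data.Product using (_×_; _,_)
open import Relation.Binary.PropositionalEquality using (_≡_)
open import Relation.Nullary.Decidable using (⌊_⌋)
open import Data.Fin using (_≟_)

-- A (set) partition of [m] = {0,…,m-1} (0-based) given by its
-- "same block" relation, which must be an equivalence relation.
BRel : ℕ → Set
BRel m = Fin m → Fin m → Bool

record Partition (m : ℕ) : Set where
  field
    same  : BRel m
    reflx : ∀ i → T (same i i)
    symm  : ∀ i j → T (same i j) → T (same j i)
    trans : ∀ i j k → T (same i j) → T (same j k) → T (same i k)
open Partition public

NoncrossingRel : ∀ {m} → BRel m → Set
NoncrossingRel {m} R =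
  ∀ (a b c d : Fin m) → a < b → b < c → c < d →
    T (R a c) → T (R b d) → T (R a b)

record NCP (m : ℕ) : Set where
  field
    part        : Partition m
    noncrossing : NoncrossingRel (same part)
open NCP public

_∣ᴿ_ : ∀ {m} → BRel m → BRel m → Set
_∣ᴿ_ {m} R S = ∀ (i j : Fin m) → T (R i j) → T (S i j)

_∣ₙ_ : ∀ {n} → NCP n → NCP n → Set
α ∣ₙ β = same (part α) ∣ᴿ same (part β)

_≈ₙ_ : ∀ {n} → NCP n → NCP n → Set
_≈ₙ_ {n} α β = ∀ (i j : Fin n) → same (part α) i j ≡ same (part β) i j

-- Positions of [2n] (0-based): combine x 0 = 2x  (the 1-based 2(x+1)-1, odd),
-- combine x 1 = 2x+1 (the 1-based 2(x+1), even).  Fin (n * 2) ≅ Fin n × Fin 2.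
oddPos : ∀ {n} → Fin n → Fin (n * 2)
oddPos x = combine x zero

evenPos : ∀ {n} → Fin n → Fin (n * 2)
evenPos x = combine x (suc zero)

starRel : ∀ {n} → NCP n → NCP n → BRel (n * 2)
starRel {n} α β k l with remQuot {n} 2 k | remQuot {n} 2 l
... | x , zero     | y , zero     = same (part α) x y
... | x , suc zero | y , suc zero = same (part β) x y
... | _ , _        | _ , _        = false

Admissible : ∀ {n} → NCP n → NCP n → Set
Admissible α β = NoncrossingRel (starRel α β)

pairsRel : ∀ {n} → BRel (n * 2)
pairsRel {n} k l with remQuot {n} 2 k | remQuot {n} 2 l
... | x , _ | y , _ = ⌊ x ≟ y ⌋

-- Join in NCP(m) of two partitions R, S (assumed noncrossing):
-- the least noncrossing upper bound, i.e. the meet (intersection) of all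
-- noncrossing partitions γ with R ∣ γ and S ∣ γ.
JoinRel : ∀ {m} → BRel m → BRel m → Fin m → Fin m → Set
JoinRel {m} R S k l =
  ∀ (γ : NCP m) → R ∣ᴿ same (part γ) → S ∣ᴿ same (part γ) → T (same (part γ) k l)

-- α ∘ β := √((α ∗ₙ β) ∨ pairs): i ~ j iff 2i and 2j (1-based) lie in the same
-- block of the join.
compRel : ∀ {n} → NCP n → NCP n → Fin n → Fin n → Set
compRel {n} α β i j = JoinRel (starRel α β) (pairsRel {n}) (evenPos i) (evenPos j)

_∣ˢ_ : ∀ {n} → (Fin n → Fin n → Set) → (Fin n → Fin n → Set) → Set
_∣ˢ_ {n} R S = ∀ (i j : Fin n) → R i j → S i j

_≈ˢ_ : ∀ {n} → (Fin n → Fin n → Set) → (Fin n → Fin n → Set) → Set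
R ≈ˢ S = (R ∣ˢ S) × (S ∣ˢ R)

{-# OPTIONS --safe #-}
-- Enlarging α or β enlarges α ∗ β, hence shrinks the family of noncrossing partitions whose meet
-- is the join; this gives both refinements.
-- For strictness, let α ∣ α′ with α ≠ α′, so that some α′-block A splits into several α-blocks.
-- As α and α′ are noncrossing, there are l < g in A such that the interval [l, g) is a union of
-- α-blocks, and admissibility of (α′, β) makes it a union of β-blocks as well. The partition of [2n]
-- into the pairs {2i-1, 2i} with i ∈ [l, g) and the remaining pairs is then noncrossing and lies above
-- α ∗ β and the pairing, yet separates 2l from 2g, which α′ ∘ β joins since l and g lie in A.
-- For β ≠ β′ the same argument runs with [n] read from right to left: admissibility of (α, β′)
-- makes the intervals (g, l] that it produces unions of α-blocks.
module Submission where

open import Defs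
open import Data.Nat using (ℕ; _*_; s<s) renaming (_<_ to _<ℕ_)
import Data.Nat.Properties as ℕ
open import Data.Fin using (Fin; zero; suc; toℕ; _<_; _≤_; combine; quotRem; quotient; opposite)
open import Data.Fin.Properties
  using (_<?_; _≤?_; ≤∧≢⇒<; any?; all?; ¬∀⟶∃¬; toℕ<n; remQuot-combine; combine-remQuot; combine-monoˡ-<;
         toℕ-combine; opposite-prop; opposite-involutive)
open import Data.Fin.Induction using (<-wellFounded; >-wellFounded)
open import Induction.WellFounded using (WellFounded; Acc; acc)
open import Data.Bool using (Bool; true; false; T)
import Data.Bool.Properties as Bool
open import Data.Product using (_×_; _,_; proj₁; proj₂; swap; Σ-syntax)
open import Data.Sum using (_⊎_; inj₁; inj₂)
open import Function using (id; _∘_)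
open import Function.Definitions using (Injective)
open import Relation.Binary.PropositionalEquality using (_≡_; _≢_; refl; sym; cong; subst; subst₂)
import Relation.Binary.PropositionalEquality as ≡
open import Relation.Unary using (Decidable)
open import Relation.Nullary using (¬_; Dec; yes; no; contradiction)
open import Relation.Nullary.Decidable using (_×-dec_; _→-dec_; ¬?; T?; isYes; toWitness; fromWitness)

module _ {n k : ℕ} {P : Fin n → Set} (P? : Decidable P) (key : Fin n → Fin k) where

  minimalBy : ∀ {_⊏_ : Fin k → Fin k → Set} → WellFounded _⊏_ → (∀ a b → Dec (a ⊏ b)) →
              ∀ x → P x → Σ[ m ∈ Fin n ] P m × (∀ z → P z → ¬ key z ⊏ key m)
  minimalBy {_⊏_} wf _⊏?_ x px = go x px (wf (key x))
    where
    go : ∀ x → P x → Acc _⊏_ (key x) → Σ[ m ∈ Fin n ] P m × (∀ z → P z → ¬ key z ⊏ key m)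
    go x px (acc rs) with any? (λ z → P? z ×-dec key z ⊏? key x)
    ... | yes (z , pz , z⊏x) = go z pz (rs z⊏x)
    ... | no ∄z             = x , px , λ z pz z⊏x → ∄z (z , pz , z⊏x)

  argmin : ∀ x → P x → Σ[ m ∈ Fin n ] P m × (∀ z → P z → key m ≤ key z)
  argmin x px with minimalBy <-wellFounded _<?_ x px
  ... | m , pm , minimal = m , pm , λ z pz → ℕ.≮⇒≥ (minimal z pz)

  argmax : ∀ x → P x → Σ[ m ∈ Fin n ] P m × (∀ z → P z → key z ≤ key m)
  argmax x px with minimalBy >-wellFounded (λ a b → b <? a) x px
  ... | m , pm , maximal = m , pm , λ z pz → ℕ.≮⇒≥ (maximal z pz)

module SameBlock {n : ℕ} (Q : Partition n) where

  infix 4 _~_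
  _~_ : Fin n → Fin n → Set
  a ~ b = T (same Q a b)

  ~-refl : ∀ {a} → a ~ a
  ~-refl = reflx Q _

  ~-sym : ∀ {a b} → a ~ b → b ~ a
  ~-sym = symm Q _ _

  ~-trans : ∀ {a b c} → a ~ b → b ~ c → a ~ c
  ~-trans = trans Q _ _ _

NoncrossingAlong : ∀ {n} → (Fin n → Fin n) → BRel n → Set
NoncrossingAlong key R = ∀ a b c d → key a < key b → key b < key c → key c < key d →
                         T (R a c) → T (R b d) → T (R a b)

Interval : ∀ {n} → (Fin n → Fin n) → Fin n → Fin n → Fin n → Set
Interval key l g z = key l ≤ key z × key z < key g

Interval? : ∀ {n} (key : Fin n → Fin n) l g → Decidable (Interval key l g)
Interval? key l g z = key l ≤? key z ×-dec key z <? key g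

Closed : ∀ {n} → BRel n → (Fin n → Set) → Set
Closed R S = ∀ z w → T (R z w) → S z → S w

module SeparatingInterval {n : ℕ} (key : Fin n → Fin n) (key-injective : Injective _≡_ _≡_ key)
  (Q Q′ : Partition n) (Q⊆Q′ : same Q ∣ᴿ same Q′)
  (Q-nc : NoncrossingAlong key (same Q)) (Q′-nc : NoncrossingAlong key (same Q′)) where

  open SameBlock Q
  open SameBlock Q′ using () renaming (_~_ to _~′_; ~-refl to ~′-refl; ~-sym to ~′-sym; ~-trans to ~′-trans)

  infix 4 _≺_ _≼_
  _≺_ _≼_ : Fin n → Fin n → Set
  a ≺ b = key a < key b
  a ≼ b = key a ≤ key b

  ≼∧≢⇒≺ : ∀ {a b} → a ≼ b → a ≢ b → a ≺ b
  ≼∧≢⇒≺ a≼b a≢b = ≤∧≢⇒< a≼b (a≢b ∘ key-injective)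

  IsLeast : Fin n → Set
  IsLeast a = ∀ b → b ~ a → a ≼ b

  IsLeast? : Decidable IsLeast
  IsLeast? a = all? (λ b → T? (same Q b a) →-dec key a ≤? key b)

  least-in-block : ∀ a → Σ[ h ∈ Fin n ] h ~ a × IsLeast h
  least-in-block a with argmin (λ z → T? (same Q z a)) key a ~-refl
  ... | h , h~a , h-min = h , h~a , λ b b~h → h-min b (~-trans b~h h~a)

  module _ (x₀ : Fin n) where

    InBlock : Fin n → Set
    InBlock z = z ~′ x₀

    Lead : Fin n → Fin n → Set
    Lead top a = InBlock a × ¬ a ~ top × IsLeast a

    After : Fin n → Fin n → Set
    After l a = InBlock a × l ≺ a × ¬ a ~ l

    InBlock? : Decidable InBlock
    InBlock? z = T? (same Q′ z x₀)

    Lead? : ∀ top → Decidable (Lead top)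
    Lead? top a = InBlock? a ×-dec ¬? (T? (same Q a top)) ×-dec IsLeast? a

    After? : ∀ l → Decidable (After l)
    After? l a = InBlock? a ×-dec key l <? key a ×-dec ¬? (T? (same Q a l))

    outside-block-of : ∀ {y₀} → x₀ ~′ y₀ → ¬ x₀ ~ y₀ → ∀ top → Σ[ u ∈ Fin n ] InBlock u × ¬ u ~ top
    outside-block-of {y₀} x₀~′y₀ x₀≁y₀ top with T? (same Q x₀ top)
    ... | yes x₀~top = y₀ , ~′-sym x₀~′y₀ , λ y₀~top → x₀≁y₀ (~-trans x₀~top (~-sym y₀~top))
    ... | no x₀≁top  = x₀ , ~′-refl , x₀≁top

    lead-of-block : ∀ {top u} → InBlock u → ¬ u ~ top → Σ[ h ∈ Fin n ] Lead top h
    lead-of-block {u = u} u∈ u≁top with h , h~u , h-least ← least-in-block u =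
      h , ~′-trans (Q⊆Q′ _ _ h~u) u∈ , (λ h~top → u≁top (~-trans (~-sym h~u) h~top)) , h-least

    top-after : ∀ {top l} → InBlock top → (∀ z → InBlock z → z ≼ top) → InBlock l → ¬ l ~ top → After l top
    top-after top∈ top-max l∈ l≁top =
      top∈ , ≼∧≢⇒≺ (top-max _ l∈) (λ l≡top → l≁top (subst (_ ~_) l≡top ~-refl)) , l≁top ∘ ~-sym

    module Chosen {top} (top-max : ∀ z → InBlock z → z ≼ top)
             {l} (l∈ : InBlock l) (l≁top : ¬ l ~ top) (l-least : IsLeast l) (l-max : ∀ z → Lead top z → z ≼ l)
             {g} (g∈ : InBlock g) (l≺g : l ≺ g) (g≁l : ¬ g ~ l) (g-min : ∀ z → After l z → g ≼ z) where

      l~′g : l ~′ g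
      l~′g = ~′-trans l∈ (~′-sym g∈)

      in-block-before-g⇒~l : ∀ {z} → InBlock z → l ≼ z → z ≺ g → z ~ l
      in-block-before-g⇒~l {z} z∈ l≼z z≺g with T? (same Q z l)
      ... | yes z~l = z~l
      ... | no z≁l  = contradiction (g-min z (z∈ , l≺z , z≁l)) (ℕ.<⇒≱ z≺g)
        where
        l≺z : l ≺ z
        l≺z = ≼∧≢⇒≺ l≼z (λ l≡z → z≁l (subst (_~ l) l≡z ~-refl))

      -- Were the block of l to reach past g, it would cross the block of g: that block is either
      -- the block of top, or its least element is a lead below l, by maximality of l.
      l-block-before-g : ∀ {w} → l ~ w → w ≺ g
      l-block-before-g {w} l~w = ℕ.≰⇒> λ g≼w → g≁l (~-sym (l~g (≼∧≢⇒≺ g≼w g≢w)))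
        where
        g≢w : g ≢ w
        g≢w g≡w = g≁l (~-sym (subst (l ~_) (sym g≡w) l~w))

        w≺top : w ≺ top
        w≺top = ≼∧≢⇒≺ (top-max w (~′-trans (Q⊆Q′ _ _ (~-sym l~w)) l∈))
                      (λ w≡top → l≁top (subst (l ~_) w≡top l~w))

        l~g : g ≺ w → l ~ g
        l~g g≺w with T? (same Q g top)
        ... | yes g~top = Q-nc l g w top l≺g g≺w w≺top l~w g~top
        ... | no g≁top with least-in-block g
        ...   | h , h~g , h-least = ~-trans (~-sym (Q-nc h l g w h≺l l≺g g≺w h~g l~w)) h~g
          where
          h-lead : Lead top h
          h-lead = ~′-trans (Q⊆Q′ _ _ h~g) g∈ , (λ h~top → g≁top (~-trans (~-sym h~g) h~top)) , h-least

          h≺l : h ≺ l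
          h≺l = ≼∧≢⇒≺ (l-max h h-lead) (λ h≡l → g≁l (~-sym (subst (_~ g) h≡l h~g)))

      interval-closed-in-block : ∀ {z w} → InBlock z → z ~ w → Interval key l g z → Interval key l g w
      interval-closed-in-block z∈ z~w (l≼z , z≺g) =
        l-least _ (~-sym l~w) , l-block-before-g l~w
        where
        l~w = ~-trans (~-sym (in-block-before-g⇒~l z∈ l≼z z≺g)) z~w

      interval-closed-off-block : ∀ {z w} → ¬ InBlock z → z ~′ w → Interval key l g z → Interval key l g w
      interval-closed-off-block {z} {w} z∉ z~′w (l≼z , z≺g) = l≼w , w≺g
        where
        l≺z : l ≺ z
        l≺z = ≼∧≢⇒≺ l≼z (λ l≡z → z∉ (subst InBlock l≡z l∈))

        l≼w : l ≼ w
        l≼w = ℕ.≮⇒≥ λ w≺l →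
          z∉ (~′-trans z~′w (~′-trans (Q′-nc w l z g w≺l l≺z z≺g (~′-sym z~′w) l~′g) l∈))

        w≺g : w ≺ g
        w≺g = ℕ.≰⇒> λ g≼w →
          let g≢w = λ g≡w → z∉ (~′-trans z~′w (subst InBlock g≡w g∈))
          in z∉ (~′-trans (~′-sym (Q′-nc l z g w l≺z z≺g (≼∧≢⇒≺ g≼w g≢w) l~′g z~′w)) l∈)

      interval-closed : Closed (same Q) (Interval key l g)
      interval-closed z w z~w with T? (same Q′ z x₀)
      ... | yes z∈ = interval-closed-in-block z∈ z~w
      ... | no z∉  = interval-closed-off-block z∉ (Q⊆Q′ _ _ z~w)

    -- top is the largest element of the Q′-block of x₀, l the largest least element of a Q-block
    -- inside it other than the Q-block of top, and g the first element after l outside the Q-block of l.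
    -- Opaque, because with-abstracting over its unfolded result makes type checking blow up.
    opaque
      separating-interval : ∀ {y₀} → x₀ ~′ y₀ → ¬ x₀ ~ y₀ →
                            Σ[ l ∈ Fin n ] Σ[ g ∈ Fin n ] l ≺ g × l ~′ g × Closed (same Q) (Interval key l g)
      separating-interval x₀~′y₀ x₀≁y₀
        with top , top∈ , top-max ← argmax InBlock? key x₀ ~′-refl
        with u , u∈ , u≁top ← outside-block-of x₀~′y₀ x₀≁y₀ top
        with h , h-lead ← lead-of-block u∈ u≁top
        with l , (l∈ , l≁top , l-least) , l-max ← argmax (Lead? top) key h h-lead
        with g , (g∈ , l≺g , g≁l) , g-min ← argmin (After? l) key top (top-after top∈ top-max l∈ l≁top)
        = l , g , l≺g , l~′g , interval-closed
        where open Chosen top-max l∈ l≁top l-least l-max g∈ l≺g g≁l g-min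

Convex : ∀ {m} → (Fin m → Set) → Set
Convex S = ∀ {a b c} → a ≤ b → b ≤ c → S a → S c → S b

module Bipartition {m : ℕ} {S : Fin m → Set} (S? : Decidable S) where

  SameSide : Fin m → Fin m → Set
  SameSide i j = (S i → S j) × (S j → S i)

  SameSide? : ∀ i j → Dec (SameSide i j)
  SameSide? i j = (S? i →-dec S? j) ×-dec (S? j →-dec S? i)

  sameSide : BRel m
  sameSide i j = isYes (SameSide? i j)

  sameSide⇒SameSide : ∀ {i j} → T (sameSide i j) → SameSide i j
  sameSide⇒SameSide {i} {j} = toWitness {a? = SameSide? i j}

  bipartition : Partition m
  bipartition = record
    { same  = sameSide
    ; reflx = λ i → fromWitness (id , id)
    ; symm  = λ i j i~j → fromWitness (swap (sameSide⇒SameSide i~j))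
    ; trans = λ i j k i~j j~k →
        let (i⇒j , j⇒i) = sameSide⇒SameSide i~j
            (j⇒k , k⇒j) = sameSide⇒SameSide j~k
        in fromWitness (j⇒k ∘ i⇒j , j⇒i ∘ k⇒j)
    }

  bipartition-noncrossing : Convex S → NoncrossingRel sameSide
  bipartition-noncrossing convex a b c d a<b b<c c<d a~c b~d =
    fromWitness ((λ Sa → convex (ℕ.<⇒≤ a<b) (ℕ.<⇒≤ b<c) Sa (a⇒c Sa)) ,
                 (λ Sb → c⇒a (convex (ℕ.<⇒≤ b<c) (ℕ.<⇒≤ c<d) Sb (b⇒d Sb))))
    where
    a⇒c = proj₁ (sameSide⇒SameSide a~c)
    c⇒a = proj₂ (sameSide⇒SameSide a~c)
    b⇒d = proj₁ (sameSide⇒SameSide b~d)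

  bipartitionNCP : Convex S → NCP m
  bipartitionNCP convex = record { part = bipartition ; noncrossing = bipartition-noncrossing convex }

quotient-mono : ∀ {n} k {p q : Fin (n * k)} → p ≤ q → quotient {n} k p ≤ quotient k q
quotient-mono {n} k {p} {q} p≤q = ℕ.≮⇒≥ λ q′<p′ →
  ℕ.<⇒≱ (subst₂ _<_ (combine-remQuot {n} k q) (combine-remQuot {n} k p) (combine-monoˡ-< _ _ q′<p′)) p≤q

quotient-combine : ∀ {n k} (x : Fin n) (i : Fin k) → quotient k (combine x i) ≡ x
quotient-combine x i = cong proj₁ (remQuot-combine x i)

evenPos<oddPos : ∀ {n} {x y : Fin n} → x < y → evenPos x < oddPos y
evenPos<oddPos = combine-monoˡ-< _ _

oddPos<evenPos : ∀ {n} {x y : Fin n} → x ≤ y → oddPos x < evenPos y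
oddPos<evenPos {x = x} {y} x≤y = subst₂ _<ℕ_ (sym (toℕ-combine x zero)) (sym (toℕ-combine y (suc zero)))
  (ℕ.+-mono-≤-< (ℕ.*-monoʳ-≤ 2 x≤y) ℕ.0<1+n)

-- remQuot unfolds to swap ∘ quotRem, so it is quotRem that has to be abstracted.
pairsRel-quotient : ∀ {n} (k l : Fin (n * 2)) → T (pairsRel {n} k l) → quotient {n} 2 k ≡ quotient 2 l
pairsRel-quotient {n} k l with quotRem {n} 2 k | quotRem {n} 2 l
... | _ , x | _ , y = toWitness

quotient-pairsRel : ∀ {n} (k l : Fin (n * 2)) → quotient {n} 2 k ≡ quotient 2 l → T (pairsRel {n} k l)
quotient-pairsRel {n} k l with quotRem {n} 2 k | quotRem {n} 2 l
... | _ , x | _ , y = fromWitness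

pairsRel-pair : ∀ {n} (x : Fin n) i j → T (pairsRel {n} (combine x i) (combine x j))
pairsRel-pair x i j = quotient-pairsRel _ _ (≡.trans (quotient-combine x i) (sym (quotient-combine x j)))

module _ {n : ℕ} (α β : NCP n) where

  starRel-oddPos : ∀ {x y} → T (same (part α) x y) → T (starRel α β (oddPos x) (oddPos y))
  starRel-oddPos {x} {y} rewrite remQuot-combine {n} {2} x zero | remQuot-combine {n} {2} y zero = id

  starRel-evenPos : ∀ {x y} → T (same (part β) x y) → T (starRel α β (evenPos x) (evenPos y))
  starRel-evenPos {x} {y} rewrite remQuot-combine {n} {2} x (suc zero) | remQuot-combine {n} {2} y (suc zero) = id

  starRel-odd-even : ∀ x y → ¬ T (starRel α β (oddPos x) (evenPos y))
  starRel-odd-even x y rewrite remQuot-combine {n} {2} x zero | remQuot-combine {n} {2} y (suc zero) = λ ()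

  starRel-even-odd : ∀ x y → ¬ T (starRel α β (evenPos x) (oddPos y))
  starRel-even-odd x y rewrite remQuot-combine {n} {2} x (suc zero) | remQuot-combine {n} {2} y zero = λ ()

  starRel-quotient : ∀ k l → T (starRel α β k l) →
    T (same (part α) (quotient 2 k) (quotient 2 l)) ⊎ T (same (part β) (quotient 2 k) (quotient 2 l))
  starRel-quotient k l with quotRem {n} 2 k | quotRem {n} 2 l
  ... | zero     , x | zero     , y = inj₁
  ... | suc zero , x | suc zero , y = inj₂
  ... | zero     , x | suc zero , y = λ ()
  ... | suc zero , x | zero     , y = λ ()

  starRel-mono : ∀ {α′ β′ : NCP n} → α ∣ₙ α′ → β ∣ₙ β′ → starRel α β ∣ᴿ starRel α′ β′
  starRel-mono α⊆α′ β⊆β′ k l with quotRem {n} 2 k | quotRem {n} 2 l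
  ... | zero     , x | zero     , y = α⊆α′ x y
  ... | suc zero , x | suc zero , y = β⊆β′ x y
  ... | zero     , x | suc zero , y = λ ()
  ... | suc zero , x | zero     , y = λ ()

JoinRel-monoˡ : ∀ {m} {R R′ S : BRel m} → R ∣ᴿ R′ → ∀ {k l} → JoinRel R S k l → JoinRel R′ S k l
JoinRel-monoˡ R⊆R′ join γ R′⊆γ S⊆γ = join γ (λ k l → R′⊆γ k l ∘ R⊆R′ k l) S⊆γ

compRel-mono : ∀ {n} {α α′ β β′ : NCP n} → α ∣ₙ α′ → β ∣ₙ β′ → compRel α β ∣ˢ compRel α′ β′
compRel-mono {α = α} {β = β} α⊆α′ β⊆β′ _ _ = JoinRel-monoˡ (starRel-mono α β α⊆α′ β⊆β′)

module _ {n : ℕ} (α β : NCP n) where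

  compRel-odd : ∀ {x y} → T (same (part α) x y) → compRel α β x y
  compRel-odd {x} {y} x~y γ star⊆γ pairs⊆γ =
    ~-trans (pairs⊆γ _ _ (pairsRel-pair x (suc zero) zero))
      (~-trans (star⊆γ _ _ (starRel-oddPos α β x~y))
               (pairs⊆γ _ _ (pairsRel-pair y zero (suc zero))))
    where open SameBlock (part γ)

  compRel-even : ∀ {x y} → T (same (part β) x y) → compRel α β x y
  compRel-even {x} {y} x~y γ star⊆γ _ = star⊆γ _ _ (starRel-evenPos α β x~y)

  -- Witnessed by the noncrossing partition of [2n] into the pairs over S and those over its complement.
  compRel-closed : ∀ {S : Fin n → Set} → Decidable S → Convex S →
                   Closed (same (part α)) S → Closed (same (part β)) S →
                   ∀ {x y} → compRel α β x y → S x → S y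
  compRel-closed {S} S? convex α-closed β-closed {x} {y} x~y =
    subst₂ (λ a b → S a → S b) (quotient-combine x (suc zero)) (quotient-combine y (suc zero))
      (proj₁ (sameSide⇒SameSide (x~y (bipartitionNCP convex₂) star⊆ pairs⊆)))
    where
    open Bipartition (S? ∘ quotient 2)

    convex₂ : Convex (S ∘ quotient 2)
    convex₂ p≤q q≤r = convex (quotient-mono 2 p≤q) (quotient-mono 2 q≤r)

    closed⇒SameSide : ∀ (Q : Partition n) → Closed (same Q) S →
                      ∀ {a b} → T (same Q a b) → (S a → S b) × (S b → S a)
    closed⇒SameSide Q Q-closed a~b = Q-closed _ _ a~b , Q-closed _ _ (symm Q _ _ a~b)

    star⊆ : starRel α β ∣ᴿ sameSide
    star⊆ k l k~l with starRel-quotient α β k l k~l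
    ... | inj₁ α~ = fromWitness (closed⇒SameSide (part α) α-closed α~)
    ... | inj₂ β~ = fromWitness (closed⇒SameSide (part β) β-closed β~)

    pairs⊆ : pairsRel {n} ∣ᴿ sameSide
    pairs⊆ k l k~l = fromWitness (subst S q≡ , subst S (sym q≡))
      where
      q≡ = pairsRel-quotient k l k~l

module _ {n : ℕ} {α β : NCP n} (admissible : Admissible α β) where

  admissible-β-nested : ∀ {x y} → T (same (part α) x y) → Closed (same (part β)) (Interval id x y)
  admissible-β-nested {x} {y} x~y z w z~w (x≤z , z<y) = x≤w , w<y
    where
    x≤w : x ≤ w
    x≤w = ℕ.≮⇒≥ λ w<x → starRel-even-odd α β w x
      (admissible _ _ _ _ (evenPos<oddPos w<x) (oddPos<evenPos x≤z) (evenPos<oddPos z<y)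
        (starRel-evenPos α β (symm (part β) z w z~w))
        (starRel-oddPos α β x~y))

    w<y : w < y
    w<y = ℕ.≰⇒> λ y≤w → starRel-odd-even α β x z
      (admissible _ _ _ _ (oddPos<evenPos x≤z) (evenPos<oddPos z<y) (oddPos<evenPos y≤w)
        (starRel-oddPos α β x~y)
        (starRel-evenPos α β z~w))

  admissible-α-nested : ∀ {x y} → T (same (part β) x y) → Closed (same (part α)) (λ z → x < z × z ≤ y)
  admissible-α-nested {x} {y} x~y z w z~w (x<z , z≤y) = x<w , w≤y
    where
    x<w : x < w
    x<w = ℕ.≰⇒> λ w≤x → starRel-odd-even α β w x
      (admissible _ _ _ _ (oddPos<evenPos w≤x) (evenPos<oddPos x<z) (oddPos<evenPos z≤y)
        (starRel-oddPos α β (symm (part α) z w z~w))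
        (starRel-evenPos α β x~y))

    w≤y : w ≤ y
    w≤y = ℕ.≮⇒≥ λ y<w → starRel-even-odd α β x z
      (admissible _ _ _ _ (evenPos<oddPos x<z) (oddPos<evenPos z≤y) (evenPos<oddPos y<w)
        (starRel-evenPos α β x~y)
        (starRel-oddPos α β z~w))

module _ {n : ℕ} where

  opposite-< : ∀ {i j : Fin n} → i < j → opposite j < opposite i
  opposite-< {i} {j} i<j = subst₂ _<ℕ_ (sym (opposite-prop j)) (sym (opposite-prop i))
    (ℕ.∸-monoʳ-< (s<s i<j) (toℕ<n j))

  opposite-reflects-< : ∀ {i j : Fin n} → opposite i < opposite j → j < i
  opposite-reflects-< {i} {j} i′<j′ =
    subst₂ _<_ (opposite-involutive j) (opposite-involutive i) (opposite-< i′<j′)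

  opposite-≤ : ∀ {i j : Fin n} → i ≤ j → opposite j ≤ opposite i
  opposite-≤ i≤j = ℕ.≮⇒≥ λ i′<j′ → ℕ.<⇒≱ (opposite-reflects-< i′<j′) i≤j

  opposite-reflects-≤ : ∀ {i j : Fin n} → opposite i ≤ opposite j → j ≤ i
  opposite-reflects-≤ i′≤j′ = ℕ.≮⇒≥ λ i<j → ℕ.<⇒≱ (opposite-< i<j) i′≤j′

  opposite-injective : Injective _≡_ _≡_ (opposite {n})
  opposite-injective {i} {j} i′≡j′ =
    ≡.trans (sym (opposite-involutive i)) (≡.trans (cong opposite i′≡j′) (opposite-involutive j))

  noncrossing-opposite : (Q : NCP n) → NoncrossingAlong opposite (same (part Q))
  noncrossing-opposite Q a b c d a′<b′ b′<c′ c′<d′ a~c b~d =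
    ~-trans a~c (~-trans (~-sym d~c) (~-sym b~d))
    where
    open SameBlock (part Q)
    d~c = noncrossing Q d c b a (opposite-reflects-< c′<d′) (opposite-reflects-< b′<c′)
                                (opposite-reflects-< a′<b′) (~-sym b~d) (~-sym a~c)

  Interval-id-convex : ∀ {l g : Fin n} → Convex (Interval id l g)
  Interval-id-convex a≤b b≤c (l≤a , _) (_ , c<g) = ℕ.≤-trans l≤a a≤b , ℕ.≤-<-trans b≤c c<g

  Interval-opposite-convex : ∀ {l g : Fin n} → Convex (Interval opposite l g)
  Interval-opposite-convex a≤b b≤c (_ , a′<g′) (l′≤c′ , _) =
    ℕ.≤-trans l′≤c′ (opposite-≤ b≤c) , ℕ.≤-<-trans (opposite-≤ a≤b) a′<g′

  closed-Interval-opposite : ∀ {R : BRel n} {l g} →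
                             Closed R (λ z → g < z × z ≤ l) → Closed R (Interval opposite l g)
  closed-Interval-opposite R-closed z w z~w (l′≤z′ , z′<g′) =
    let g<w , w≤l = R-closed z w z~w (opposite-reflects-< z′<g′ , opposite-reflects-≤ l′≤z′)
    in opposite-≤ w≤l , opposite-< g<w

strict-implication : ∀ {a b : Bool} → (T a → T b) → a ≢ b → T b × ¬ T a
strict-implication {false} {false} _   a≢b = contradiction refl a≢b
strict-implication {false} {true}  _   _   = _ , λ ()
strict-implication {true}  {false} a⇒b _   = contradiction (a⇒b _) λ ()
strict-implication {true}  {true}  _   a≢b = contradiction refl a≢b

strict-refinement-witness : ∀ {n} {α α′ : NCP n} → α ∣ₙ α′ → ¬ α ≈ₙ α′ →
                            Σ[ x ∈ Fin n ] Σ[ y ∈ Fin n ] T (same (part α′) x y) × ¬ T (same (part α) x y)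
strict-refinement-witness {n} {α} {α′} α⊆α′ α≉α′ =
  let x , ¬∀y  = ¬∀⟶∃¬ n _ (λ x → all? (agree? x)) α≉α′
      y , α≢α′ = ¬∀⟶∃¬ n _ (agree? x) ¬∀y
  in x , y , strict-implication (α⊆α′ x y) α≢α′
  where
  agree? : ∀ x y → Dec (same (part α) x y ≡ same (part α′) x y)
  agree? x y = same (part α) x y Bool.≟ same (part α′) x y

module _ {n : ℕ} where

  compRel-strictˡ : ∀ {α α′ β : NCP n} → α ∣ₙ α′ → Admissible α′ β → ¬ α ≈ₙ α′ →
                    Σ[ l ∈ Fin n ] Σ[ g ∈ Fin n ] compRel α′ β l g × ¬ compRel α β l g
  compRel-strictˡ {α} {α′} {β} α⊆α′ admissible α≉α′
    with x₀ , y₀ , x₀~′y₀ , x₀≁y₀ ← strict-refinement-witness {α = α} {α′} α⊆α′ α≉α′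
    with l , g , l<g , l~′g , α-closed ← SeparatingInterval.separating-interval id id (part α) (part α′)
                                             α⊆α′ (noncrossing α) (noncrossing α′) x₀ x₀~′y₀ x₀≁y₀
    = l , g , compRel-odd α′ β l~′g , λ l~g → ℕ.<-irrefl refl (proj₂ (g∈Interval l~g))
    where
    g∈Interval : compRel α β l g → Interval id l g g
    g∈Interval l~g = compRel-closed α β (Interval? id l g) Interval-id-convex
                       α-closed (admissible-β-nested admissible l~′g) l~g (ℕ.≤-refl , l<g)

  compRel-strictʳ : ∀ {α β β′ : NCP n} → β ∣ₙ β′ → Admissible α β′ → ¬ β ≈ₙ β′ →
                    Σ[ l ∈ Fin n ] Σ[ g ∈ Fin n ] compRel α β′ l g × ¬ compRel α β l g
  compRel-strictʳ {α} {β} {β′} β⊆β′ admissible β≉β′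
    with x₀ , y₀ , x₀~′y₀ , x₀≁y₀ ← strict-refinement-witness {α = β} {β′} β⊆β′ β≉β′
    with l , g , l′<g′ , l~′g , β-closed ← SeparatingInterval.separating-interval opposite opposite-injective
                                               (part β) (part β′) β⊆β′ (noncrossing-opposite β)
                                               (noncrossing-opposite β′) x₀ x₀~′y₀ x₀≁y₀
    = l , g , compRel-even α β′ l~′g , λ l~g → ℕ.<-irrefl refl (proj₂ (g∈Interval l~g))
    where
    α-closed : Closed (same (part α)) (Interval opposite l g)
    α-closed = closed-Interval-opposite (admissible-α-nested admissible (symm (part β′) l g l~′g))

    g∈Interval : compRel α β l g → Interval opposite l g g
    g∈Interval l~g = compRel-closed α β (Interval? opposite l g) Interval-opposite-convex
                       α-closed β-closed l~g (ℕ.≤-refl , l′<g′)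

witness⇒≉ˢ : ∀ {n} {R R′ : Fin n → Fin n → Set} → Σ[ l ∈ Fin n ] Σ[ g ∈ Fin n ] R′ l g × ¬ R l g → ¬ R ≈ˢ R′
witness⇒≉ˢ (l , g , R′lg , ¬Rlg) (_ , R′⊆R) = ¬Rlg (R′⊆R l g R′lg)

lemma3p16 : (n : ℕ) (α α' β β' : NCP n) →
    α ∣ₙ α' → β ∣ₙ β' →
    Admissible α β → Admissible α' β → Admissible α β' →
    (compRel α β ∣ˢ compRel α' β) × (compRel α β ∣ˢ compRel α β')
    × (¬ (α ≈ₙ α') → ¬ (compRel α β ≈ˢ compRel α' β))
    × (¬ (β ≈ₙ β') → ¬ (compRel α β ≈ˢ compRel α β'))
lemma3p16 n α α' β β' α∣α' β∣β' _ admissible' admissible'' =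
  compRel-mono α∣α' (λ _ _ → id) ,
  compRel-mono (λ _ _ → id) β∣β' ,
  (λ α≉α' → witness⇒≉ˢ (compRel-strictˡ α∣α' admissible' α≉α')) ,
  (λ β≉β' → witness⇒≉ˢ (compRel-strictʳ β∣β' admissible'' β≉β'))
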